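{- Let $G$ be a connected finite simple graph whose detour diameter $s^{\ast}$ satisfies $s^{\ast}\ge 2$. Then the $(s^{\ast}-1)$-shunt intersection graph $A_{s^{\ast}-1}(G)$ is a complete graph.
   Context: The detour diameter of a connected graph is the length (number of edges) of a longest path in it. For an integer $s\ge1$, an $s$-arc on distinct vertices of $G$ is a sequence $(v_0,\dots,v_s)$ of pairwise distinct vertices with $v_iv_{i+1}\in E(G)$ for $0\le i<s$. Such an $s$-arc $(v_0,\dots,v_s)$ can be shunted onto the $s$-arc $(v_1,\dots,v_{s+1})$ if $(v_0,\dots,v_{s+1})$ is an $(s+1)$-arc on distinct vertices. $A_s(G)$ has as vertices the $s$-arcs on distinct vertices that can be shunted onto some other $s$-arc on distinct vertices; two distinct vertices are adjacent iff the corresponding $s$-arcs share at least one vertex of $G$. -}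

module Defs where

open import Data.Nat using (ℕ; _≤_) renaming (suc to sucℕ)
open import Data.Fin using (Fin; zero; suc; inject₁; fromℕ)
open import Data.Product using (Σ; ∃; ∃-syntax; _×_; _,_; proj₁)
open import Relation.Nullary using (¬_)
open import Relation.Binary.PropositionalEquality using (_≡_; _≢_)
open import Function.Definitions using (Injective)

record Graph (n : ℕ) : Set₁ where
  field
    Adj   : Fin n → Fin n → Set
    sym   : ∀ {u v} → Adj u v → Adj v u
    irrefl : ∀ {v} → ¬ Adj v v

module _ {n : ℕ} (G : Graph n) where
  open Graph G

  record Arc (s : ℕ) : Set where
    constructor arc
    field
      vtx      : Fin (sucℕ s) → Fin n
      distinct : Injective _≡_ _≡_ vtx
      step     : ∀ (i : Fin s) → Adj (vtx (inject₁ i)) (vtx (suc i))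

  IsDetourDiameter : ℕ → Set
  IsDetourDiameter d = Arc d × (∀ m → Arc m → m ≤ d)

  Connected : Set
  Connected = ∀ (u v : Fin n) →
    ∃[ m ] ∃[ p ] (Arc.vtx {m} p zero ≡ u × Arc.vtx p (fromℕ m) ≡ v)

  -- (v_0..v_s) can be shunted onto (v_1..v_{s+1}): (v_0..v_{s+1}) is an
  -- (s+1)-arc on distinct vertices.
  ShuntsOnto : ∀ {s} → Arc s → Arc s → Set
  ShuntsOnto {s} a b = ∃[ c ] ((∀ i → Arc.vtx {sucℕ s} c (inject₁ i) ≡ Arc.vtx a i)
                              × (∀ i → Arc.vtx c (suc i) ≡ Arc.vtx b i))

  SameArc : ∀ {s} → Arc s → Arc s → Set
  SameArc a b = ∀ i → Arc.vtx a i ≡ Arc.vtx b i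

  -- Vertices of A_s(G): s-arcs that can be shunted onto some other s-arc.
  Shuntable : ∀ {s} → Arc s → Set
  Shuntable a = ∃[ b ] (¬ SameArc a b × ShuntsOnto a b)

  -- Adjacency in A_s(G): distinct arcs sharing at least one vertex of G.
  ShareVertex : ∀ {s} → Arc s → Arc s → Set
  ShareVertex a b = ∃[ i ] ∃[ j ] (Arc.vtx a i ≡ Arc.vtx b j)

  AIsComplete : ℕ → Set
  AIsComplete s = ∀ (a b : Arc s) → Shuntable a → Shuntable b →
                  ¬ SameArc a b → ShareVertex a b

-- Two longest paths of a connected graph share a vertex: otherwise a path
-- joining them and meeting them only at its ends, prolonged by the longer
-- halves of both paths from those ends, is longer still. For s = s* − 1, an
-- s-arc A that shunts onto another s-arc extends to an arc A x of length s*,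
-- i.e. a longest path. If two such arcs A and B were disjoint, A x and B y
-- would meet, which is only possible at x or y; but if x lies on B y (or y on
-- A), the longer half of B y from x (of A from y) prolongs A x (B y) to a path
-- longer than s*.
module Submission where

open import Defs
open import Data.Fin.Base using (Fin; zero; suc; inject₁; fromℕ)
open import Data.Fin.Properties using (any?) renaming (_≟_ to _≟ᶠ_)
open import Data.List.Base
  using (List; []; _∷_; _++_; _∷ʳ_; _ʳ++_; [_]; reverse; tabulate; lookup; length)
open import Data.List.Properties
  using (++-assoc; reverse-++; unfold-reverse; tabulate-cong;
         length-++; length-++-≤ˡ; length-reverse; length-tabulate)
open import Data.List.Relation.Unary.Linked using (Linked; []; [-]; _∷_)
open import Data.List.Relation.Unary.AllPairs using ([]; _∷_)
open import Data.List.Relation.Unary.All as All using (All; []; _∷_)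
import Data.List.Relation.Unary.All.Properties as All
open import Data.List.Relation.Unary.Any using (Any; here; there)
open import Data.List.Relation.Unary.Any.Properties using (reverse⁺; reverse⁻)
open import Data.List.Relation.Unary.Unique.Propositional using (Unique)
import Data.List.Relation.Unary.Unique.Propositional.Properties as Unique
open import Data.List.Relation.Binary.Disjoint.Propositional using (Disjoint)
import Data.List.Relation.Binary.Disjoint.Propositional.Properties as Disjoint
open import Data.List.Relation.Binary.Subset.Propositional using (_⊆_)
open import Data.List.Membership.Propositional using (_∈_; _∉_; lose)
open import Data.List.Membership.Propositional.Properties
  using (∈-++⁺ˡ; ∈-++⁺ʳ; ∈-++⁻; ∈-∃++; ∈-lookup; ∈-tabulate⁺; ∈-tabulate⁻)
import Data.List.Membership.DecPropositional as DecMembership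
import Data.List.Relation.Binary.Permutation.Setoid as Permutation
import Data.List.Relation.Binary.Permutation.Setoid.Properties as Permutation
open import Data.Nat.Base using (ℕ; suc; _+_; _≤_; _<_; _≥_; _∸_; z≤n; s≤s)
open import Data.Nat.Properties
  using (_≤?_; ≤-refl; ≤-reflexive; ≤-trans; <⇒≱; ≰⇒≥; 1+n≰n; m+1+n≰m; m≤m+n;
         +-suc; +-mono-≤; +-monoˡ-≤; +-monoʳ-<; module ≤-Reasoning)
open import Data.Nat.Tactic.RingSolver using (solve-∀)
open import Data.Product.Base using (∃-syntax; _×_; _,_; proj₁; proj₂)
open import Data.Sum.Base using (inj₁; inj₂)
open import Function.Base using (_∘_)
open import Relation.Binary.Core using (Rel)
open import Relation.Binary.Definitions using (Symmetric)
open import Relation.Binary.PropositionalEquality using (_≡_; refl; sym; trans; cong; cong₂; subst; setoid)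
open import Relation.Nullary using (¬_; yes; no; contradiction; decidable-stable)
open import Relation.Unary using (Pred; Decidable; ∁)

module _ {a ℓ} {A : Set a} {R : Rel A ℓ} where

  Linked-++⁻ˡ : ∀ xs {ys} → Linked R (xs ++ ys) → Linked R xs
  Linked-++⁻ˡ []           _        = []
  Linked-++⁻ˡ (x ∷ [])     _        = [-]
  Linked-++⁻ˡ (x ∷ y ∷ xs) (r ∷ rs) = r ∷ Linked-++⁻ˡ (y ∷ xs) rs

  Linked-++⁻ʳ : ∀ xs {ys} → Linked R (xs ++ ys) → Linked R ys
  Linked-++⁻ʳ []           rs       = rs
  Linked-++⁻ʳ (x ∷ [])     [-]      = []
  Linked-++⁻ʳ (x ∷ [])     (_ ∷ rs) = rs
  Linked-++⁻ʳ (x ∷ y ∷ xs) (_ ∷ rs) = Linked-++⁻ʳ (y ∷ xs) rs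

  Linked-glue : ∀ xs {p ys} → Linked R (xs ∷ʳ p) → Linked R (p ∷ ys) → Linked R (xs ++ p ∷ ys)
  Linked-glue []           _        rs = rs
  Linked-glue (x ∷ [])     (r ∷ _)  rs = r ∷ rs
  Linked-glue (x ∷ y ∷ xs) (r ∷ rs) ss = r ∷ Linked-glue (y ∷ xs) rs ss

  Linked-ʳ++ : Symmetric R → ∀ xs {x ys} → Linked R (x ∷ xs) → Linked R (x ∷ ys) → Linked R (xs ʳ++ x ∷ ys)
  Linked-ʳ++ R-sym []       _        ss = ss
  Linked-ʳ++ R-sym (y ∷ xs) (r ∷ rs) ss = Linked-ʳ++ R-sym xs rs (R-sym r ∷ ss)

  Linked-reverse : Symmetric R → ∀ {xs} → Linked R xs → Linked R (reverse xs)
  Linked-reverse R-sym {[]}     [] = []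
  Linked-reverse R-sym {x ∷ xs} rs = Linked-ʳ++ R-sym xs rs [-]

  Linked-tabulate : ∀ {n} {f : Fin (suc n) → A} → (∀ i → R (f (inject₁ i)) (f (suc i))) → Linked R (tabulate f)
  Linked-tabulate {0}     r = [-]
  Linked-tabulate {suc n} {f} r = r zero ∷ Linked-tabulate {f = f ∘ suc} (r ∘ suc)

  Linked-lookup : ∀ {x xs} → Linked R (x ∷ xs) → ∀ (i : Fin (length xs)) →
                  R (lookup (x ∷ xs) (inject₁ i)) (lookup (x ∷ xs) (suc i))
  Linked-lookup (r ∷ rs) zero    = r
  Linked-lookup (r ∷ rs) (suc i) = Linked-lookup rs i

module _ {a} {A : Set a} where

  tabulate-∷ʳ : ∀ {n} (f : Fin (suc n) → A) → tabulate f ≡ tabulate (f ∘ inject₁) ∷ʳ f (fromℕ n)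
  tabulate-∷ʳ {0}     f = refl
  tabulate-∷ʳ {suc n} f = cong (f zero ∷_) (tabulate-∷ʳ (f ∘ suc))

  Unique-reverse : ∀ {xs : List A} → Unique xs → Unique (reverse xs)
  Unique-reverse {xs} =
    Permutation.Unique-resp-↭ (setoid A) (Permutation.↭-sym (setoid A) (Permutation.↭-reverse (setoid A) xs))

  Unique-++⁻ : ∀ (xs : List A) {ys} → Unique (xs ++ ys) → Unique xs × Unique ys × Disjoint xs ys
  Unique-++⁻ []       u = [] , u , λ ()
  Unique-++⁻ (x ∷ xs) (x≢ ∷ u) with Unique-++⁻ xs u
  ... | uxs , uys , xs#ys = All.++⁻ˡ xs x≢ ∷ uxs , uys , x∷xs#ys
    where
    x∷xs#ys : Disjoint (x ∷ xs) _
    x∷xs#ys (here refl  , v∈ys) = All.lookup (All.++⁻ʳ xs x≢) v∈ys refl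
    x∷xs#ys (there v∈xs , v∈ys) = xs#ys (v∈xs , v∈ys)

  Disjoint-∷ʳ⁺ : ∀ {xs ys : List A} {y} → Disjoint xs ys → y ∉ xs → Disjoint xs (ys ∷ʳ y)
  Disjoint-∷ʳ⁺ {ys = ys} xs#ys y∉xs (v∈xs , v∈ys∷ʳy) with ∈-++⁻ ys v∈ys∷ʳy
  ... | inj₁ v∈ys        = xs#ys (v∈xs , v∈ys)
  ... | inj₂ (here refl) = y∉xs v∈xs

  Unique-lookup-injective : ∀ {xs : List A} → Unique xs → ∀ {i j} → lookup xs i ≡ lookup xs j → i ≡ j
  Unique-lookup-injective (x≢ ∷ u) {zero}  {zero}  _ = refl
  Unique-lookup-injective (x≢ ∷ u) {zero}  {suc j} e = contradiction e (All.lookup x≢ (∈-lookup j))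
  Unique-lookup-injective (x≢ ∷ u) {suc i} {zero}  e = contradiction (sym e) (All.lookup x≢ (∈-lookup i))
  Unique-lookup-injective (x≢ ∷ u) {suc i} {suc j} e = cong suc (Unique-lookup-injective u e)

  split-at-first : ∀ {p} {P : Pred A p} → Decidable P → ∀ {xs} → Any P xs →
                   ∃[ ys ] ∃[ y ] ∃[ zs ] xs ≡ ys ++ y ∷ zs × All (∁ P) ys × P y
  split-at-first P? {x ∷ xs} any with P? x | any
  ... | yes px  | _         = [] , x , xs , refl , [] , px
  ... | no  ¬px | here px   = contradiction px ¬px
  ... | no  ¬px | there any' with split-at-first P? any'
  ...   | ys , y , zs , refl , ¬Pys , py = x ∷ ys , y , zs , refl , ¬px ∷ ¬Pys , py

m+1+n≤1+k+k : ∀ {m n k} → m ≤ k → n ≤ k → m + suc n ≤ suc (k + k)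
m+1+n≤1+k+k {m} {n} m≤k n≤k = ≤-trans (≤-reflexive (+-suc m n)) (s≤s (+-mono-≤ m≤k n≤k))

-- A bridge with i inner vertices, prolonged at both ends by halves of lengths u and w.
bridged-halves-bound : ∀ {m n u w i} → m ≤ suc (u + u) → n ≤ suc (w + w) →
                       m + n + 2 ≤ (w + suc (i + suc u)) + (w + suc (i + suc u))
bridged-halves-bound {u = u} {w} {i} m≤ n≤ =
  ≤-trans (+-monoˡ-≤ 2 (+-mono-≤ m≤ n≤)) (≤-trans (m≤m+n _ (i + i)) (≤-reflexive (regroup u w i)))
  where
  regroup : ∀ u w i → suc (u + u) + suc (w + w) + 2 + (i + i) ≡ (w + suc (i + suc u)) + (w + suc (i + suc u))
  regroup = solve-∀

module _ {n : ℕ} (G : Graph n) where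
  open Graph G renaming (sym to Adj-sym)
  open DecMembership (_≟ᶠ_ {n}) using (_∈?_)

  IsPath : List (Fin n) → Set
  IsPath xs = Linked Adj xs × Unique xs

  path-reverse : ∀ {xs} → IsPath xs → IsPath (reverse xs)
  path-reverse (l , u) = Linked-reverse Adj-sym l , Unique-reverse u

  path-++⁻ˡ : ∀ xs {ys} → IsPath (xs ++ ys) → IsPath xs
  path-++⁻ˡ xs (l , u) = Linked-++⁻ˡ xs l , proj₁ (Unique-++⁻ xs u)

  path-++⁻ʳ : ∀ xs {ys} → IsPath (xs ++ ys) → IsPath ys
  path-++⁻ʳ xs (l , u) = Linked-++⁻ʳ xs l , proj₁ (proj₂ (Unique-++⁻ xs u))

  path-glue : ∀ xs {p ys} → IsPath (xs ∷ʳ p) → IsPath (p ∷ ys) → Disjoint xs ys → IsPath (xs ++ p ∷ ys)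
  path-glue xs {p} (l , u) (l′ , u′) xs#ys with Unique-++⁻ xs u
  ... | uxs , _ , xs#p = Linked-glue xs l l′ , Unique.++⁺ uxs u′ xs#p∷ys
    where
    xs#p∷ys : Disjoint xs (p ∷ _)
    xs#p∷ys (v∈xs , here v≡p)    = xs#p (v∈xs , here v≡p)
    xs#p∷ys (v∈xs , there v∈ys) = xs#ys (v∈xs , v∈ys)

  path-split : ∀ xs {p ys} → IsPath (xs ++ p ∷ ys) → IsPath (p ∷ ys) × IsPath (p ∷ reverse xs)
  path-split xs {p} {ys} π =
    path-++⁻ʳ xs π ,
    subst IsPath (reverse-++ xs [ p ])
          (path-reverse (path-++⁻ˡ (xs ∷ʳ p) (subst IsPath (sym (++-assoc xs [ p ] ys)) π)))

  arc⇒path : ∀ {s} (α : Arc G s) → IsPath (tabulate (Arc.vtx α))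
  arc⇒path α = Linked-tabulate {f = Arc.vtx α} (Arc.step α) , Unique.tabulate⁺ (Arc.distinct α)

  path⇒arc : ∀ {x xs} → IsPath (x ∷ xs) → Arc G (length xs)
  path⇒arc (l , u) = arc _ (Unique-lookup-injective u) (Linked-lookup l)

  IsLongestPath : List (Fin n) → Set
  IsLongestPath xs = IsPath xs × (∀ {ys} → IsPath ys → length ys ≤ length xs)

  arc-longest : ∀ {s} → (∀ m → Arc G m → m ≤ s) → (α : Arc G s) → IsLongestPath (tabulate (Arc.vtx α))
  arc-longest bound α = arc⇒path α , length-bound
    where
    length-bound : ∀ {ys} → IsPath ys → length ys ≤ length (tabulate (Arc.vtx α))
    length-bound {[]}     _ = z≤n
    length-bound {y ∷ ys} π =
      ≤-trans (s≤s (bound _ (path⇒arc π))) (≤-reflexive (sym (length-tabulate (Arc.vtx α))))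

  path-half : ∀ {P p} → IsPath P → p ∈ P →
              ∃[ W ] IsPath (p ∷ W) × W ⊆ P × length P ≤ suc (length W + length W)
  path-half {p = p} π p∈P with ∈-∃++ p∈P
  ... | xs , ys , refl with path-split xs π | length xs ≤? length ys
  ...   | π-ys , _ | yes xs≤ys =
          ys , π-ys , (λ v∈ys → ∈-++⁺ʳ xs (there v∈ys)) ,
          ≤-trans (≤-reflexive (length-++ xs)) (m+1+n≤1+k+k xs≤ys ≤-refl)
  ...   | _ , π-xs | no xs≰ys =
          reverse xs , π-xs , (λ v∈xs → ∈-++⁺ˡ {ys = p ∷ ys} (reverse⁻ v∈xs)) ,
          ≤-trans (≤-reflexive (length-++ xs))
                  (≤-trans (m+1+n≤1+k+k ≤-refl (≰⇒≥ xs≰ys))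
                           (≤-reflexive (cong (λ k → suc (k + k)) (sym (length-reverse xs)))))

  path-extend : ∀ A {x Q} → IsPath (A ∷ʳ x) → IsPath Q → x ∈ Q → Disjoint A Q → 2 ≤ length Q →
                ∃[ L ] IsPath L × length (A ∷ʳ x) < length L
  path-extend A {x} πA πQ x∈Q A#Q 2≤Q with path-half πQ x∈Q
  ... | [] , _ , _ , Q≤1 = contradiction (≤-trans 2≤Q Q≤1) 1+n≰n
  ... | W@(_ ∷ W′) , πW , W⊆Q , _ =
        A ++ x ∷ W , path-glue A πA πW (λ (v∈A , v∈W) → A#Q (v∈A , W⊆Q v∈W)) , longer
    where
    longer : length (A ∷ʳ x) < length (A ++ x ∷ W)
    longer = begin-strict
      length (A ∷ʳ x)         ≡⟨ length-++ A ⟩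
      length A + 1            <⟨ +-monoʳ-< (length A) (s≤s (s≤s z≤n)) ⟩
      length A + length (x ∷ W) ≡⟨ length-++ A ⟨
      length (A ++ x ∷ W)     ∎
      where open ≤-Reasoning

  record Bridge (P Q : List (Fin n)) : Set where
    field
      q p      : Fin n
      interior : List (Fin n)
      q∈Q      : q ∈ Q
      p∈P      : p ∈ P
      avoids   : ∀ {v} → v ∈ interior → v ∉ P × v ∉ Q
      isPath   : IsPath ((q ∷ interior) ∷ʳ p)

  -- The bridge runs backwards from the first vertex of Q on the path to the last vertex of P before it.
  bridge : ∀ {P Q x xs} → Disjoint P Q → IsPath (x ∷ xs) → x ∈ P → Any (_∈ Q) (x ∷ xs) → Bridge P Q
  bridge {P} {Q} {x} P#Q π x∈P hits-Q with split-at-first (_∈? Q) hits-Q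
  ... | [] , _ , _ , refl , _ , x∈Q = contradiction (x∈P , x∈Q) P#Q
  ... | A@(_ ∷ _) , q , B , refl , A∉Q , q∈Q
        with split-at-first (_∈? P) (reverse⁺ {xs = A} (here x∈P))
  ...   | C , p , D , reverse-A≡ , C∉P , p∈P = record
          { q = q ; p = p ; interior = C ; q∈Q = q∈Q ; p∈P = p∈P
          ; avoids = λ v∈C → All.lookup C∉P v∈C ,
                             All.lookup A∉Q (reverse⁻ (subst (_ ∈_) (sym reverse-A≡) (∈-++⁺ˡ v∈C)))
          ; isPath = path-++⁻ˡ ((q ∷ C) ∷ʳ p)
                       (subst IsPath (sym (++-assoc (q ∷ C) [ p ] D))
                         (subst (λ ys → IsPath (q ∷ ys)) reverse-A≡ (proj₂ (path-split A π))))
          }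

  shunt-longest : ∀ {s} → (∀ m → Arc G m → m ≤ suc s) → (α : Arc G s) (γ : Arc G (suc s)) →
                  (∀ i → Arc.vtx γ (inject₁ i) ≡ Arc.vtx α i) →
                  IsLongestPath (tabulate (Arc.vtx α) ∷ʳ Arc.vtx γ (fromℕ (suc s)))
  shunt-longest {s} bound α γ γ≈α =
    subst IsLongestPath
          (trans (tabulate-∷ʳ (Arc.vtx γ)) (cong (_∷ʳ Arc.vtx γ (fromℕ (suc s))) (tabulate-cong γ≈α)))
          (arc-longest bound γ)

  module _ (connected : Connected G) where

    disjoint-paths-bridged : ∀ {P Q u v} → IsPath P → IsPath Q → Disjoint P Q → u ∈ P → v ∈ Q →
                             ∃[ L ] IsPath L × length P + length Q + 2 ≤ length L + length L
    disjoint-paths-bridged {P} {Q} {u} {v} πP πQ P#Q u∈P v∈Q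
      with connected u v
    ... | m , α , α₀≡u , αₘ≡v
      with bridge P#Q (arc⇒path α) (subst (_∈ P) (sym α₀≡u) u∈P)
                  (lose (∈-tabulate⁺ {f = Arc.vtx α} (fromℕ m)) (subst (_∈ Q) (sym αₘ≡v) v∈Q))
    ... | record { q = q ; p = p ; interior = I ; q∈Q = q∈Q ; p∈P = p∈P ; avoids = avoids ; isPath = πI }
      with path-half πP p∈P | path-half πQ q∈Q
    ... | U , πU , U⊆P , P≤U | W , πW , W⊆Q , Q≤W =
          L , πL ,
          subst (λ l → _ ≤ l + l) (sym length-L)
                (bridged-halves-bound {u = length U} {length W} {length I} P≤U Q≤W)
      where
      L = reverse W ++ q ∷ I ++ p ∷ U

      qI#U : Disjoint (q ∷ I) U
      qI#U (here refl  , v∈U) = P#Q (U⊆P v∈U , q∈Q)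
      qI#U (there v∈I , v∈U) = proj₁ (avoids v∈I) (U⊆P v∈U)

      W#IpU : Disjoint (reverse W) (I ++ p ∷ U)
      W#IpU (v∈W , v∈IpU) with W⊆Q (reverse⁻ v∈W) | ∈-++⁻ I v∈IpU
      ... | v∈Q | inj₁ v∈I          = proj₂ (avoids v∈I) v∈Q
      ... | v∈Q | inj₂ (here refl)  = P#Q (p∈P , v∈Q)
      ... | v∈Q | inj₂ (there v∈U) = P#Q (U⊆P v∈U , v∈Q)

      πL : IsPath L
      πL = path-glue (reverse W) (subst IsPath (unfold-reverse q W) (path-reverse πW))
                     (path-glue (q ∷ I) πI πU qI#U) W#IpU

      length-L : length L ≡ length W + suc (length I + suc (length U))
      length-L = trans (length-++ (reverse W)) (cong₂ _+_ (length-reverse W) (cong suc (length-++ I)))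

    longest-paths-meet : ∀ {P Q u v} → IsLongestPath P → IsLongestPath Q → u ∈ P → v ∈ Q → ¬ Disjoint P Q
    longest-paths-meet {P} {Q} (πP , P-max) (πQ , Q-max) u∈P v∈Q P#Q =
      let L , πL , P+Q+2≤2L = disjoint-paths-bridged πP πQ P#Q u∈P v∈Q
      in  m+1+n≰m (length P + length Q) (≤-trans P+Q+2≤2L (+-mono-≤ (P-max πL) (Q-max πL)))

    longest-extensions-meet : ∀ A B {x y} → IsLongestPath (A ∷ʳ x) → IsLongestPath (B ∷ʳ y) →
                              2 ≤ length A → ¬ Disjoint A B
    longest-extensions-meet A B {x} {y} (πAx , Ax-max) (πBy , By-max) 2≤A A#B with y ∈? A | x ∈? (B ∷ʳ y)
    ... | yes y∈A | _
          with path-extend B πBy (path-++⁻ˡ A πAx) y∈A (Disjoint.sym A#B) 2≤A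
    ...   | _ , πL , By<L = <⇒≱ By<L (By-max πL)
    longest-extensions-meet A B {x} {y} (πAx , Ax-max) (πBy , By-max) 2≤A A#B | no y∉A | yes x∈By
          with path-extend A πAx πBy x∈By (Disjoint-∷ʳ⁺ A#B y∉A)
                           (≤-trans 2≤A (≤-trans (length-++-≤ˡ A) (By-max πAx)))
    ...   | _ , πL , Ax<L = <⇒≱ Ax<L (Ax-max πL)
    longest-extensions-meet A B {x} {y} (πAx , Ax-max) (πBy , By-max) 2≤A A#B | no y∉A | no x∉By =
      longest-paths-meet (πAx , Ax-max) (πBy , By-max) (∈-++⁺ʳ A (here refl)) (∈-++⁺ʳ B (here refl))
        (Disjoint.sym (Disjoint-∷ʳ⁺ (Disjoint.sym (Disjoint-∷ʳ⁺ A#B y∉A)) x∉By))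

mainTheorem4 : ∀ {n : ℕ} (G : Graph n) (s* : ℕ) →
    Connected G → IsDetourDiameter G s* → s* ≥ 2 →
    AIsComplete G (s* ∸ 1)
mainTheorem4 G (suc (suc k)) connected (_ , bound) (s≤s (s≤s z≤n))
             α β (_ , _ , γ , γ≈α , _) (_ , _ , δ , δ≈β , _) _ =
  decidable-stable (any? λ i → any? λ j → Arc.vtx α i ≟ᶠ Arc.vtx β j) λ ¬shared →
    longest-extensions-meet G connected (tabulate (Arc.vtx α)) (tabulate (Arc.vtx β))
      (shunt-longest G bound α γ γ≈α) (shunt-longest G bound β δ δ≈β)
      (≤-trans (s≤s (s≤s z≤n)) (≤-reflexive (sym (length-tabulate (Arc.vtx α)))))
      λ (v∈α , v∈β) → ¬shared (shared v∈α v∈β)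
  where
  shared : ∀ {v} → v ∈ tabulate (Arc.vtx α) → v ∈ tabulate (Arc.vtx β) → ShareVertex G α β
  shared v∈α v∈β with ∈-tabulate⁻ v∈α | ∈-tabulate⁻ v∈β
  ... | i , v≡αᵢ | j , v≡βⱼ = i , j , trans (sym v≡αᵢ) v≡βⱼ
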